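{- For integers $1\le k\le n$, let $p'_{n,k}$ denote the number of permutations of $[n]$ that have a common interval of cardinality $k$. Then for every fixed positive integer $c$, $$\sum_{k=c+2}^{n-c}\frac{p'_{n,k}}{n!}=O(n^{ -c})\quad\text{as } n\to\infty.$$
   Context: A common interval of a permutation $\sigma$ of $[n]$ is a subset of $[n]$ which is the set of entries of some segment of consecutive positions of $\sigma$ and which is also a set of consecutive integers $\{a,a+1,\dots,b\}$. -}

module Defs where

open import Data.Nat using (ℕ; zero; suc; _+_; _∸_; _≤_; _<_; _≤?_; _<?_)
open import Data.Fin using (Fin; toℕ)
open import Data.Fin.Properties using (any?; all?) renaming (_≟_ to _≟ᶠ_)
open import Data.Vec using (Vec; []; _∷_; lookup)
open import Data.List using (List; []; _∷_; concatMap; map; filter; length; applyUpTo)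
open import Data.Nat.ListAction using (sum)
open import Data.Product using (∃; _×_; _,_)
open import Relation.Binary.PropositionalEquality using (_≡_)
open import Relation.Nullary using (Dec)
open import Relation.Nullary.Decidable using (_×-dec_; _→-dec_)

-- A permutation of [n] is represented (0-based) by its one-line notation
-- σ : Vec (Fin n) n, i.e. position p ↦ lookup σ p, required to be injective.
IsPerm : ∀ {n} → Vec (Fin n) n → Set
IsPerm {n} σ = ∀ (i j : Fin n) → lookup σ i ≡ lookup σ j → i ≡ j

isPerm? : ∀ {n} (σ : Vec (Fin n) n) → Dec (IsPerm σ)
isPerm? σ = all? (λ i → all? (λ j → (lookup σ i ≟ᶠ lookup σ j) →-dec (i ≟ᶠ j)))

InSeg : ∀ {n} → Fin n → ℕ → Fin n → Set
InSeg i k p = toℕ i ≤ toℕ p × toℕ p < toℕ i + k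

inSeg? : ∀ {n} (i : Fin n) (k : ℕ) (p : Fin n) → Dec (InSeg i k p)
inSeg? i k p = (toℕ i ≤? toℕ p) ×-dec (toℕ p <? toℕ i + k)

InIntv : ∀ {n} → Fin n → ℕ → Fin n → Set
InIntv a k v = toℕ a ≤ toℕ v × toℕ v < toℕ a + k

inIntv? : ∀ {n} (a : Fin n) (k : ℕ) (v : Fin n) → Dec (InIntv a k v)
inIntv? a k v = (toℕ a ≤? toℕ v) ×-dec (toℕ v <? toℕ a + k)

HasCommonInterval : ∀ {n} → Vec (Fin n) n → ℕ → Set
HasCommonInterval {n} σ k =
  ∃ λ (i : Fin n) → ∃ λ (a : Fin n) →
    (toℕ i + k ≤ n)
    × (∀ (p : Fin n) → InSeg i k p → InIntv a k (lookup σ p))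
    × (∀ (v : Fin n) → InIntv a k v → ∃ λ (p : Fin n) → InSeg i k p × lookup σ p ≡ v)

hasCommonInterval? : ∀ {n} (σ : Vec (Fin n) n) (k : ℕ) → Dec (HasCommonInterval σ k)
hasCommonInterval? {n} σ k =
  any? λ i → any? λ a →
    (toℕ i + k ≤? n)
    ×-dec all? (λ p → inSeg? i k p →-dec inIntv? a k (lookup σ p))
    ×-dec all? (λ v → inIntv? a k v →-dec any? (λ p → inSeg? i k p ×-dec (lookup σ p ≟ᶠ v)))

allVecs : (n m : ℕ) → List (Vec (Fin n) m)
allVecs n zero = [] ∷ []
allVecs n (suc m) = concatMap (λ x → map (x ∷_) (allVecs n m)) (Data.List.allFin n)
  where import Data.List

p′ : ℕ → ℕ → ℕ
p′ n k = length (filter (λ σ → isPerm? σ ×-dec hasCommonInterval? σ k) (allVecs n n))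

-- Σ_{k = c+2}^{n-c} p'_{n,k}  (empty sum if n - c < c + 2)
S : ℕ → ℕ → ℕ
S n c = sum (applyUpTo (λ j → p′ n (c + 2 + j)) ((n ∸ c) ∸ (c + 1)))

module Submission where

-- Fix a start i of the segment of positions and a start a of the interval of values
-- (n − k + 1 choices each). A permutation realising them is an injective placement of the
-- k segment positions into the k interval values and of the other n − k positions into the
-- other n − k values, so p′(n,k) ≤ (n−k+1)² k! (n−k)! ≤ k! (n−k+2)!. The map k ↦ k! (n+2−k)!
-- decreases towards the middle, hence in S the two end terms are (c+2)! (n−c)! and each of
-- the at most n others is at most (c+3)! (n−c−1)!. Multiplying by n^c and using
-- n^c (n−c)! ≤ 2^c n! gives n^c S ≤ C n!.

open import Data.Bool using (Bool; true; false)
open import Data.Fin using (Fin; zero; suc; toℕ; fromℕ<)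
import Data.Fin.Properties as Fin
open import Data.List using (List; []; _∷_; _++_; map; concatMap; filter; length; applyUpTo; upTo; allFin)
open import Data.List.Membership.Propositional using (_∈_; _∉_; lose)
open import Data.List.Membership.Propositional.Properties using (∈-upTo⁺; ∈-allFin; ∈-++⁺ˡ; ∈-++⁺ʳ)
open import Data.List.Properties using (length-++; filter-++; filter-none; applyUpTo-∷ʳ; map-cong; map-applyUpTo)
open import Data.List.Relation.Binary.Sublist.Propositional using (⊆-refl)
open import Data.List.Relation.Binary.Sublist.Propositional.Properties using (filter⁺; length-mono-≤)
open import Data.List.Relation.Unary.All using (All; universal)
import Data.List.Relation.Unary.All as All
open import Data.List.Relation.Unary.AllPairs using ([]; _∷_)
open import Data.List.Relation.Unary.Any using (Any; here; there; any?)
open import Data.List.Relation.Unary.Unique.Propositional using (Unique)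
open import Data.List.Relation.Unary.Unique.Propositional.Properties using (allFin⁺)
open import Data.Nat using (ℕ; zero; suc; _+_; _*_; _∸_; _^_; _≤_; _<_; _<?_; _≤?_; z≤n; s≤s; s≤s⁻¹; z<s; s<s; pred; _!)
open import Data.Nat.ListAction using (sum)
open import Data.Nat.ListAction.Properties using (sum-++)
open import Data.Nat.Properties
open import Data.Nat.Tactic.RingSolver using (solve-∀)
open import Data.Product using (∃; _×_; _,_; proj₁; proj₂)
import Data.Product as Product
open import Data.Sum using (_⊎_; inj₁; inj₂)
open import Data.Unit using (⊤; tt)
open import Data.Vec using (Vec; []; _∷_; lookup)
import Data.Vec as Vec
open import Function using (_∘_; id)
open import Relation.Binary.Definitions using (DecidableEquality)
open import Relation.Binary.PropositionalEquality
open import Relation.Nullary using (yes; no; ¬_; contradiction)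
open import Relation.Nullary.Decidable using (_×-dec_; T?)
open import Relation.Unary using (Decidable)

open import Defs

open import Algebra.Properties.CommutativeSemigroup *-commutativeSemigroup using (x∙yz≈y∙xz)

count : {A : Set} {P : A → Set} → Decidable P → List A → ℕ
count P? xs = length (filter P? xs)

module _ {A : Set} {P : A → Set} (P? : Decidable P) where

  count-mono : {Q : A → Set} (Q? : Decidable Q) → (∀ {x} → P x → Q x) →
               ∀ xs → count P? xs ≤ count Q? xs
  count-mono Q? P⇒Q xs = length-mono-≤ (filter⁺ P? Q? (λ { refl → P⇒Q }) (⊆-refl {x = xs}))

  count-none : ∀ {xs} → All (λ x → ¬ P x) xs → count P? xs ≡ 0
  count-none ¬Ps = cong length (filter-none P? ¬Ps)

  count-++ : ∀ xs ys → count P? (xs ++ ys) ≡ count P? xs + count P? ys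
  count-++ xs ys = trans (cong length (filter-++ P? xs ys)) (length-++ (filter P? xs))

  count-⊎ : {Q R : A → Set} (Q? : Decidable Q) (R? : Decidable R) →
            (∀ {x} → P x → Q x ⊎ R x) → ∀ xs → count P? xs ≤ count Q? xs + count R? xs
  count-⊎ Q? R? split [] = z≤n
  count-⊎ Q? R? split (x ∷ xs) with ih ← count-⊎ Q? R? split xs | P? x | Q? x | R? x
  ... | yes _  | yes _  | yes _  = s≤s (≤-trans ih (+-monoʳ-≤ _ (n≤1+n _)))
  ... | yes _  | yes _  | no _   = s≤s ih
  ... | yes _  | no _   | yes _  = ≤-trans (s≤s ih) (≤-reflexive (sym (+-suc _ _)))
  ... | no _   | yes _  | yes _  = m≤n⇒m≤1+n (≤-trans ih (+-monoʳ-≤ _ (n≤1+n _)))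
  ... | no _   | yes _  | no _   = m≤n⇒m≤1+n ih
  ... | no _   | no _   | yes _  = ≤-trans ih (+-monoʳ-≤ _ (n≤1+n _))
  ... | no _   | no _   | no _   = ih
  ... | yes px | no ¬qx | no ¬rx with split px
  ...   | inj₁ qx = contradiction qx ¬qx
  ...   | inj₂ rx = contradiction rx ¬rx

module _ {A B : Set} {P : B → Set} (P? : Decidable P) where

  count-map : (f : A → B) → ∀ xs → count P? (map f xs) ≡ count (P? ∘ f) xs
  count-map f [] = refl
  count-map f (x ∷ xs) with P? (f x)
  ... | yes _ = cong suc (count-map f xs)
  ... | no _  = count-map f xs

  count-concatMap : (f : A → List B) → ∀ xs →
                    count P? (concatMap f xs) ≡ sum (map (count P? ∘ f) xs)
  count-concatMap f [] = refl
  count-concatMap f (x ∷ xs) =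
    trans (count-++ P? (f x) (concatMap f xs)) (cong (count P? (f x) +_) (count-concatMap f xs))

count-any : {A B : Set} {Q : B → A → Set} (Q? : ∀ y → Decidable (Q y)) (ys : List B) (xs : List A) →
            count (λ x → any? (λ y → Q? y x) ys) xs ≤ sum (map (λ y → count (Q? y) xs) ys)
count-any Q? [] xs = ≤-reflexive (count-none _ (universal (λ _ ()) xs))
count-any {Q = Q} Q? (y ∷ ys) xs =
  ≤-trans (count-⊎ (λ x → any? (λ y → Q? y x) (y ∷ ys)) (Q? y) (λ x → any? (λ y → Q? y x) ys) uncons xs)
          (+-monoʳ-≤ _ (count-any Q? ys xs))
  where
    uncons : ∀ {x} → Any (λ y → Q y x) (y ∷ ys) → Q y x ⊎ Any (λ y → Q y x) ys
    uncons (here q)  = inj₁ q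
    uncons (there a) = inj₂ a

!-mono-≤ : ∀ {m n} → m ≤ n → m ! ≤ n !
!-mono-≤ {zero}  {n}     _         = 1≤n! n
!-mono-≤ {suc m} {suc n} (s≤s m≤n) = *-mono-≤ (s≤s m≤n) (!-mono-≤ m≤n)

n*pred[n]!≤n! : ∀ n → n * pred n ! ≤ n !
n*pred[n]!≤n! zero    = z≤n
n*pred[n]!≤n! (suc n) = ≤-refl

sum-applyUpTo≤ : ∀ (f : ℕ → ℕ) {β} L → (∀ {j} → j < L → f j ≤ β) → sum (applyUpTo f L) ≤ L * β
sum-applyUpTo≤ f zero    f≤β = z≤n
sum-applyUpTo≤ f (suc L) f≤β = +-mono-≤ (f≤β z<s) (sum-applyUpTo≤ (f ∘ suc) L (f≤β ∘ s<s))

sum-upTo≤ : ∀ (f : ℕ → ℕ) {β} L → (∀ {j} → j < L → f j ≤ β) → sum (map f (upTo L)) ≤ L * β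
sum-upTo≤ f L f≤β rewrite map-applyUpTo id f L = sum-applyUpTo≤ f L f≤β

module Placements {X : Set} (_≟_ : DecidableEquality X) where

  open import Data.List.Membership.DecPropositional _≟_ using (_∈?_)

  remove : X → List X → List X
  remove x [] = []
  remove x (y ∷ ys) with x ≟ y
  ... | yes _ = ys
  ... | no _  = y ∷ remove x ys

  length-remove : ∀ {x} A → x ∈ A → suc (length (remove x A)) ≡ length A
  length-remove {x} (y ∷ ys) x∈ with x ≟ y | x∈
  ... | yes _   | _         = refl
  ... | no x≢y  | here x≡y  = contradiction x≡y x≢y
  ... | no _    | there x∈′ = cong suc (length-remove ys x∈′)

  ∈-remove⁺ : ∀ {x z} A → z ∈ A → z ≢ x → z ∈ remove x A
  ∈-remove⁺ {x} (y ∷ ys) z∈ z≢x with x ≟ y | z∈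
  ... | yes x≡y | here z≡y  = contradiction (trans z≡y (sym x≡y)) z≢x
  ... | yes _   | there z∈′ = z∈′
  ... | no _    | here z≡y  = here z≡y
  ... | no _    | there z∈′ = there (∈-remove⁺ ys z∈′ z≢x)

  ∈-remove⁻ : ∀ {x z} A → z ∈ remove x A → z ∈ A
  ∈-remove⁻ {x} (y ∷ ys) z∈ with x ≟ y | z∈
  ... | yes _ | z∈′       = there z∈′
  ... | no _  | here z≡y  = here z≡y
  ... | no _  | there z∈′ = there (∈-remove⁻ ys z∈′)

  sum-unique≤ : (h : X → ℕ) (β : ℕ) {xs : List X} (A : List X) → Unique xs →
                 (∀ {x} → x ∈ A → h x ≤ β) → (∀ {x} → x ∈ xs → x ∉ A → h x ≡ 0) →
                 sum (map h xs) ≤ length A * β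
  sum-unique≤ h β A [] h≤β h≡0 = z≤n
  sum-unique≤ h β {x ∷ xs} A (x≢xs ∷ u) h≤β h≡0 with x ∈? A
  ... | no x∉A rewrite h≡0 (here refl) x∉A = sum-unique≤ h β A u h≤β (h≡0 ∘ there)
  ... | yes x∈A = begin
      h x + sum (map h xs)
        ≤⟨ +-mono-≤ (h≤β x∈A) (sum-unique≤ h β (remove x A) u (h≤β ∘ ∈-remove⁻ A) h′≡0) ⟩
      β + length (remove x A) * β
        ≡⟨ cong (_* β) (length-remove A x∈A) ⟩
      length A * β ∎
    where
      open ≤-Reasoning
      h′≡0 : ∀ {y} → y ∈ xs → y ∉ remove x A → h y ≡ 0
      h′≡0 y∈xs y∉A′ = h≡0 (there y∈xs) (λ y∈A → y∉A′ (∈-remove⁺ A y∈A (≢-sym (All.lookup x≢xs y∈xs))))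

  -- Each chosen value is removed from its pool, which forces the entries of v to be distinct.
  Placement : ∀ {m} → List X → List X → Vec Bool m → Vec X m → Set
  Placement A B []           []      = ⊤
  Placement A B (true ∷ cs)  (x ∷ v) = x ∈ A × Placement (remove x A) B cs v
  Placement A B (false ∷ cs) (x ∷ v) = x ∈ B × Placement A (remove x B) cs v

  placement? : ∀ {m} A B (cs : Vec Bool m) → Decidable (Placement A B cs)
  placement? A B []           []      = yes tt
  placement? A B (true ∷ cs)  (x ∷ v) = (x ∈? A) ×-dec placement? (remove x A) B cs v
  placement? A B (false ∷ cs) (x ∷ v) = (x ∈? B) ×-dec placement? A (remove x B) cs v

  placement⇒count-T≤length : ∀ {m A B} {cs : Vec Bool m} {v} → Placement A B cs v → Vec.count T? cs ≤ length A
  placement⇒count-T≤length {cs = []}          {[]}    _         = z≤n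
  placement⇒count-T≤length {A = A} {cs = true ∷ cs} {x ∷ v} (x∈A , p) =
    ≤-trans (s≤s (placement⇒count-T≤length p)) (≤-reflexive (length-remove A x∈A))
  placement⇒count-T≤length {cs = false ∷ cs} {x ∷ v} (_ , p) = placement⇒count-T≤length p

  injective⇒placement : ∀ {m} (v : Vec X m) (cs : Vec Bool m) A B →
    (∀ p q → lookup v p ≡ lookup v q → p ≡ q) →
    (∀ p → lookup cs p ≡ true → lookup v p ∈ A) →
    (∀ p → lookup cs p ≡ false → lookup v p ∈ B) →
    Placement A B cs v
  injective⇒placement []      []           A B inj inA inB = tt
  injective⇒placement (x ∷ v) (true ∷ cs)  A B inj inA inB =
    inA zero refl ,
    injective⇒placement v cs (remove x A) B (λ p q → Fin.suc-injective ∘ inj (suc p) (suc q))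
      (λ p e → ∈-remove⁺ A (inA (suc p) e) (λ e′ → Fin.0≢1+n (inj zero (suc p) (sym e′))))
      (inB ∘ suc)
  injective⇒placement (x ∷ v) (false ∷ cs) A B inj inA inB =
    inB zero refl ,
    injective⇒placement v cs A (remove x B) (λ p q → Fin.suc-injective ∘ inj (suc p) (suc q))
      (inA ∘ suc)
      (λ p e → ∈-remove⁺ B (inB (suc p) e) (λ e′ → Fin.0≢1+n (inj zero (suc p) (sym e′))))

module _ {n : ℕ} where

  open Placements (Fin._≟_ {n})

  count-allVecs-suc≤ : ∀ {m} {P : Vec (Fin n) (suc m) → Set} (P? : Decidable P) (A : List (Fin n)) {β} →
    (∀ {x v} → P (x ∷ v) → x ∈ A) →
    (∀ {x} → x ∈ A → count (P? ∘ (x ∷_)) (allVecs n m) ≤ β) →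
    count P? (allVecs n (suc m)) ≤ length A * β
  count-allVecs-suc≤ {m} P? A {β} head∈A bound = begin
    count P? (allVecs n (suc m))
      ≡⟨ count-concatMap P? (λ x → map (x ∷_) (allVecs n m)) (allFin n) ⟩
    sum (map (λ x → count P? (map (x ∷_) (allVecs n m))) (allFin n))
      ≡⟨ cong sum (map-cong (λ x → count-map P? (x ∷_) (allVecs n m)) (allFin n)) ⟩
    sum (map (λ x → count (P? ∘ (x ∷_)) (allVecs n m)) (allFin n))
      ≤⟨ sum-unique≤ _ _ A (allFin⁺ n) bound
           (λ _ x∉A → count-none _ (universal (λ _ p → x∉A (head∈A p)) (allVecs n m))) ⟩
    length A * β ∎
    where open ≤-Reasoning

  count-placements≤ : ∀ {m} (cs : Vec Bool m) (A B : List (Fin n)) →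
    count (placement? A B cs) (allVecs n m) ≤ length A ! * length B !
  count-placements≤ []                   A B = *-mono-≤ (1≤n! (length A)) (1≤n! (length B))
  count-placements≤ {suc m} (true ∷ cs)  A B = begin
    count (placement? A B (true ∷ cs)) (allVecs n (suc m))
      ≤⟨ count-allVecs-suc≤ (placement? A B (true ∷ cs)) A proj₁ placements-after ⟩
    length A * (pred (length A) ! * length B !)
      ≡⟨ *-assoc (length A) _ _ ⟨
    length A * pred (length A) ! * length B !
      ≤⟨ *-monoˡ-≤ (length B !) (n*pred[n]!≤n! (length A)) ⟩
    length A ! * length B ! ∎
    where
      open ≤-Reasoning
      placements-after : ∀ {x} → x ∈ A →
        count (placement? A B (true ∷ cs) ∘ (x ∷_)) (allVecs n m) ≤ pred (length A) ! * length B !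
      placements-after {x} x∈A rewrite sym (cong pred (length-remove A x∈A)) =
        ≤-trans (count-mono _ (placement? (remove x A) B cs) proj₂ (allVecs n m)) (count-placements≤ cs (remove x A) B)
  count-placements≤ {suc m} (false ∷ cs) A B = begin
    count (placement? A B (false ∷ cs)) (allVecs n (suc m))
      ≤⟨ count-allVecs-suc≤ (placement? A B (false ∷ cs)) B proj₁ placements-after ⟩
    length B * (length A ! * pred (length B) !)
      ≡⟨ x∙yz≈y∙xz (length B) (length A !) (pred (length B) !) ⟩
    length A ! * (length B * pred (length B) !)
      ≤⟨ *-monoʳ-≤ (length A !) (n*pred[n]!≤n! (length B)) ⟩
    length A ! * length B ! ∎
    where
      open ≤-Reasoning
      placements-after : ∀ {x} → x ∈ B →
        count (placement? A B (false ∷ cs) ∘ (x ∷_)) (allVecs n m) ≤ length A ! * pred (length B) !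
      placements-after {x} x∈B rewrite sym (cong pred (length-remove B x∈B)) =
        ≤-trans (count-mono _ (placement? A (remove x B) cs) proj₂ (allVecs n m)) (count-placements≤ cs A (remove x B))

segment : ℕ → ℕ → (n : ℕ) → Vec Bool n
segment _       _       zero    = []
segment zero    zero    (suc n) = false ∷ segment zero zero n
segment zero    (suc k) (suc n) = true ∷ segment zero k n
segment (suc i) k       (suc n) = false ∷ segment i k n

lookup-segment⁻ : ∀ i k {n} (p : Fin n) → lookup (segment i k n) p ≡ true → i ≤ toℕ p × toℕ p < i + k
lookup-segment⁻ zero    zero    (suc p) e with lookup-segment⁻ zero zero p e
... | _ , ()
lookup-segment⁻ zero    (suc k) zero    e = z≤n , s≤s z≤n
lookup-segment⁻ zero    (suc k) (suc p) e = z≤n , s≤s (proj₂ (lookup-segment⁻ zero k p e))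
lookup-segment⁻ (suc i) k       (suc p) e = Product.map s≤s s≤s (lookup-segment⁻ i k p e)

lookup-segment⁺ : ∀ i k {n} (p : Fin n) → i ≤ toℕ p → toℕ p < i + k → lookup (segment i k n) p ≡ true
lookup-segment⁺ zero    (suc k) zero    _         _        = refl
lookup-segment⁺ zero    (suc k) (suc p) _         (s≤s lt) = lookup-segment⁺ zero k p z≤n lt
lookup-segment⁺ (suc i) k       (suc p) (s≤s le) (s≤s lt) = lookup-segment⁺ i k p le lt

count-segment : ∀ i k n → i + k ≤ n → Vec.count T? (segment i k n) ≡ k
count-segment zero    zero    zero    _        = refl
count-segment zero    zero    (suc n) _        = count-segment zero zero n z≤n
count-segment zero    (suc k) (suc n) (s≤s le) = cong suc (count-segment zero k n le)
count-segment (suc i) k       (suc n) (s≤s le) = count-segment i k n le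

module _ {n : ℕ} where

  range : ℕ → ℕ → List (Fin n)
  range lo zero      = []
  range lo (suc len) with lo <? n
  ... | yes lo<n = fromℕ< lo<n ∷ range (suc lo) len
  ... | no _     = range (suc lo) len

  length-range≤len : ∀ lo len → length (range lo len) ≤ len
  length-range≤len lo zero      = z≤n
  length-range≤len lo (suc len) with lo <? n
  ... | yes _ = s≤s (length-range≤len (suc lo) len)
  ... | no _  = m≤n⇒m≤1+n (length-range≤len (suc lo) len)

  length-range≤n∸lo : ∀ lo len → length (range lo len) ≤ n ∸ lo
  length-range≤n∸lo lo zero      = z≤n
  length-range≤n∸lo lo (suc len) with lo <? n
  ... | yes lo<n = ≤-trans (s≤s (length-range≤n∸lo (suc lo) len)) (≤-reflexive (sym (+-∸-assoc 1 lo<n)))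
  ... | no _     = ≤-trans (length-range≤n∸lo (suc lo) len) (∸-monoʳ-≤ n (n≤1+n lo))

  ∈-range⁺ : ∀ lo len (v : Fin n) → lo ≤ toℕ v → toℕ v < lo + len → v ∈ range lo len
  ∈-range⁺ lo zero      v lo≤v v<lo+0 = contradiction (≤-trans v<lo+0 (≤-reflexive (+-identityʳ lo))) (≤⇒≯ lo≤v)
  ∈-range⁺ lo (suc len) v lo≤v v<lo+len with lo <? n | m≤n⇒m<n∨m≡n lo≤v
  ... | no lo≮n | _        = contradiction (≤-<-trans lo≤v (Fin.toℕ<n v)) lo≮n
  ... | yes _   | inj₂ refl = here (sym (Fin.fromℕ<-toℕ v _))
  ... | yes _   | inj₁ lo<v = there (∈-range⁺ (suc lo) len v lo<v (≤-trans v<lo+len (≤-reflexive (+-suc lo len))))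

module CommonIntervals (n k : ℕ) where

  open Placements (Fin._≟_ {n})

  interval outside : ℕ → List (Fin n)
  interval a = range a k
  outside  a = range 0 a ++ range (a + k) n

  Placed : ℕ → ℕ → Vec (Fin n) n → Set
  Placed i a = Placement (interval a) (outside a) (segment i k n)

  placed? : ∀ i a → Decidable (Placed i a)
  placed? i a = placement? (interval a) (outside a) (segment i k n)

  starts : List ℕ
  starts = upTo (suc (n ∸ k))

  common-interval⇒placed : ∀ {σ} → IsPerm σ × HasCommonInterval σ k →
                           Any (λ i → Any (λ a → Placed i a σ) starts) starts
  common-interval⇒placed {σ} (perm , i , a , i+k≤n , seg⇒intv , intv⇒seg) =
    lose (∈-upTo⁺ (s≤s (m+n≤o⇒m≤o∸n (toℕ i) i+k≤n)))
         (lose (∈-upTo⁺ (s≤s (m+n≤o⇒m≤o∸n (toℕ a) a+k≤n))) placed)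
    where
      seg : Vec Bool n
      seg = segment (toℕ i) k n

      inInterval : ∀ p → lookup seg p ≡ true → lookup σ p ∈ interval (toℕ a)
      inInterval p e = let a≤σp , σp<a+k = seg⇒intv p (lookup-segment⁻ (toℕ i) k p e)
                       in ∈-range⁺ (toℕ a) k _ a≤σp σp<a+k

      -- HasCommonInterval does not bound a; the k segment entries inject into the interval,
      -- which has at most n ∸ a elements below n.
      k≤n∸a : k ≤ n ∸ toℕ a
      k≤n∸a = begin
        k                             ≡⟨ count-segment (toℕ i) k n i+k≤n ⟨
        Vec.count T? seg              ≤⟨ placement⇒count-T≤length
                                           (injective⇒placement σ seg _ (allFin n) perm inInterval (λ p _ → ∈-allFin _)) ⟩
        length (interval (toℕ a))     ≤⟨ length-range≤n∸lo (toℕ a) k ⟩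
        n ∸ toℕ a                     ∎
        where open ≤-Reasoning

      a+k≤n : toℕ a + k ≤ n
      a+k≤n = subst (_≤ n) (+-comm k (toℕ a)) (m≤o∸n⇒m+n≤o k (<⇒≤ (Fin.toℕ<n a)) k≤n∸a)

      inOutside : ∀ p → lookup seg p ≡ false → lookup σ p ∈ outside (toℕ a)
      inOutside p e with toℕ a ≤? toℕ (lookup σ p) | toℕ (lookup σ p) <? toℕ a + k
      ... | no σp<a | _ = ∈-++⁺ˡ (∈-range⁺ 0 (toℕ a) _ z≤n (≰⇒> σp<a))
      ... | yes _   | no a+k≤σp =
        ∈-++⁺ʳ (range 0 (toℕ a)) (∈-range⁺ (toℕ a + k) n _ (≮⇒≥ a+k≤σp) (<-≤-trans (Fin.toℕ<n _) (m≤n+m n _)))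
      ... | yes a≤σp | yes σp<a+k with intv⇒seg (lookup σ p) (a≤σp , σp<a+k)
      ...   | q , (i≤q , q<i+k) , σq≡σp with perm q p σq≡σp
      ...     | refl = contradiction (trans (sym e) (lookup-segment⁺ (toℕ i) k q i≤q q<i+k)) λ ()

      placed : Placed (toℕ i) (toℕ a) σ
      placed = injective⇒placement σ seg _ _ perm inInterval inOutside

  length-outside≤ : ∀ {a} → a ≤ n ∸ k → length (outside a) ≤ n ∸ k
  length-outside≤ {a} a≤n∸k = begin
    length (range 0 a ++ range (a + k) n)          ≡⟨ length-++ (range 0 a) ⟩
    length (range 0 a) + length (range (a + k) n)  ≤⟨ +-mono-≤ (length-range≤len 0 a) (length-range≤n∸lo (a + k) n) ⟩
    a + (n ∸ (a + k))                              ≡⟨ cong (λ m → a + (n ∸ m)) (+-comm a k) ⟩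
    a + (n ∸ (k + a))                              ≡⟨ cong (a +_) (∸-+-assoc n k a) ⟨
    a + (n ∸ k ∸ a)                                ≡⟨ m+[n∸m]≡n a≤n∸k ⟩
    n ∸ k                                          ∎
    where open ≤-Reasoning

  count-placed≤ : ∀ i {a} → a ≤ n ∸ k → count (placed? i a) (allVecs n n) ≤ k ! * (n ∸ k) !
  count-placed≤ i {a} a≤n∸k = ≤-trans (count-placements≤ (segment i k n) (interval a) (outside a))
    (*-mono-≤ (!-mono-≤ (length-range≤len a k)) (!-mono-≤ (length-outside≤ a≤n∸k)))

  p′≤ : p′ n k ≤ suc (n ∸ k) * (suc (n ∸ k) * (k ! * (n ∸ k) !))
  p′≤ = begin
    p′ n k
      ≤⟨ count-mono _ (λ σ → any? (λ i → any? (λ a → placed? i a σ) starts) starts)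
                    common-interval⇒placed (allVecs n n) ⟩
    count (λ σ → any? (λ i → any? (λ a → placed? i a σ) starts) starts) (allVecs n n)
      ≤⟨ count-any (λ i σ → any? (λ a → placed? i a σ) starts) starts (allVecs n n) ⟩
    sum (map (λ i → count (λ σ → any? (λ a → placed? i a σ) starts) (allVecs n n)) starts)
      ≤⟨ sum-upTo≤ _ (suc (n ∸ k)) (λ {i} _ → ≤-trans (count-any (placed? i) starts (allVecs n n))
           (sum-upTo≤ _ (suc (n ∸ k)) (λ a<L → count-placed≤ i (s≤s⁻¹ a<L)))) ⟩
    suc (n ∸ k) * (suc (n ∸ k) * (k ! * (n ∸ k) !)) ∎
    where open ≤-Reasoning

p′≤ : ∀ {k l n} → k + l ≡ n → p′ n k ≤ k ! * (2 + l) !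
p′≤ {k} {l} refl = begin
  p′ (k + l) k                                      ≤⟨ CommonIntervals.p′≤ (k + l) k ⟩
  suc (k + l ∸ k) * (suc (k + l ∸ k) * (k ! * (k + l ∸ k) !))
                                                    ≡⟨ cong (λ m → suc m * (suc m * (k ! * m !))) (m+n∸m≡n k l) ⟩
  suc l * (suc l * (k ! * l !))                     ≡⟨ cong (suc l *_) (x∙yz≈y∙xz (suc l) (k !) (l !)) ⟩
  suc l * (k ! * (suc l * l !))                     ≡⟨ x∙yz≈y∙xz (suc l) (k !) _ ⟩
  k ! * (suc l * (suc l * l !))                     ≤⟨ *-monoʳ-≤ (k !) (*-monoˡ-≤ (suc l * l !) (n≤1+n (suc l))) ⟩
  k ! * (2 + l) !                                   ∎
  where open ≤-Reasoning

[a+d]!*b!≤a!*[b+d]! : ∀ {a b} d → a ≤ b → (a + d) ! * b ! ≤ a ! * (b + d) !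
[a+d]!*b!≤a!*[b+d]! {a} {b} zero    a≤b rewrite +-identityʳ a | +-identityʳ b = ≤-refl
[a+d]!*b!≤a!*[b+d]! {a} {b} (suc d) a≤b rewrite +-suc a d | +-suc b d = begin
  suc (a + d) * (a + d) ! * b !      ≡⟨ *-assoc (suc (a + d)) ((a + d) !) (b !) ⟩
  suc (a + d) * ((a + d) ! * b !)    ≤⟨ *-mono-≤ (s≤s (+-monoˡ-≤ d a≤b)) ([a+d]!*b!≤a!*[b+d]! d a≤b) ⟩
  suc (b + d) * (a ! * (b + d) !)    ≡⟨ x∙yz≈y∙xz (suc (b + d)) (a !) _ ⟩
  a ! * suc (b + d) !                ∎
  where open ≤-Reasoning

n^c*m!≤2^c*n! : ∀ c {m n} → m + c ≡ n → c ≤ 2 + m → n ^ c * m ! ≤ 2 ^ c * n !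
n^c*m!≤2^c*n! zero    {m} refl _ rewrite +-identityʳ m = ≤-refl
n^c*m!≤2^c*n! (suc c) {m} {n} m+1+c≡n 1+c≤2+m = begin
  n * n ^ c * m !           ≡⟨ trans (*-assoc n (n ^ c) (m !)) (x∙yz≈y∙xz n (n ^ c) (m !)) ⟩
  n ^ c * (n * m !)         ≤⟨ *-monoʳ-≤ (n ^ c) (*-monoˡ-≤ (m !) n≤2[1+m]) ⟩
  n ^ c * (2 * suc m * m !) ≡⟨ regroup (n ^ c) m (m !) ⟩
  2 * (n ^ c * suc m !)     ≤⟨ *-monoʳ-≤ 2 (n^c*m!≤2^c*n! c (trans (sym (+-suc m c)) m+1+c≡n) c≤3+m) ⟩
  2 * (2 ^ c * n !)         ≡⟨ *-assoc 2 (2 ^ c) (n !) ⟨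
  2 ^ suc c * n !           ∎
  where
    open ≤-Reasoning
    double : ∀ m → m + (2 + m) ≡ 2 * suc m
    double = solve-∀
    c≤3+m : c ≤ 3 + m
    c≤3+m = m≤n⇒m≤1+n (m≤n⇒m≤1+n (s≤s⁻¹ 1+c≤2+m))
    n≤2[1+m] : n ≤ 2 * suc m
    n≤2[1+m] = begin
      n            ≡⟨ m+1+c≡n ⟨
      m + suc c    ≤⟨ +-monoʳ-≤ m 1+c≤2+m ⟩
      m + (2 + m)  ≡⟨ double m ⟩
      2 * suc m    ∎
    regroup : ∀ x m y → x * (2 * suc m * y) ≡ 2 * (x * (suc m * y))
    regroup = solve-∀

sum-applyUpTo-ends≤ : ∀ (g : ℕ → ℕ) M {E F} → g 0 ≤ E → g (suc M) ≤ E → (∀ {j} → j < M → g (suc j) ≤ F) →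
                      sum (applyUpTo g (2 + M)) ≤ E + (M * F + E)
sum-applyUpTo-ends≤ g M {E} {F} g0≤E gM≤E middle≤F = begin
  g 0 + sum (applyUpTo (g ∘ suc) (suc M))                ≡⟨ cong (λ xs → g 0 + sum xs) (applyUpTo-∷ʳ (g ∘ suc) M) ⟨
  g 0 + sum (applyUpTo (g ∘ suc) M ++ g (suc M) ∷ [])    ≡⟨ cong (g 0 +_) (sum-++ (applyUpTo (g ∘ suc) M) _) ⟩
  g 0 + (sum (applyUpTo (g ∘ suc) M) + (g (suc M) + 0))  ≤⟨ +-mono-≤ g0≤E (+-mono-≤ (sum-applyUpTo≤ (g ∘ suc) M middle≤F)
                                                                          (≤-trans (≤-reflexive (+-identityʳ _)) gM≤E)) ⟩
  E + (M * F + E)                                        ∎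
  where open ≤-Reasoning

module Estimate (c : ℕ) where

  C : ℕ
  C = 2 ^ suc c * ((2 + c) ! + (3 + c) !)

  module _ (M : ℕ) where

    n : ℕ
    n = M + (c + c + 3)

    E F : ℕ
    E = (2 + c) ! * (3 + (c + M)) !
    F = (3 + c) ! * (2 + (c + M)) !

    term : ℕ → ℕ
    term j = p′ n (c + 2 + j)

    number-of-terms : (n ∸ c) ∸ (c + 1) ≡ 2 + M
    number-of-terms = begin
      n ∸ c ∸ (c + 1)                    ≡⟨ cong (λ m → m ∸ c ∸ (c + 1)) (split c M) ⟩
      2 + M + (c + 1) + c ∸ c ∸ (c + 1)  ≡⟨ cong (_∸ (c + 1)) (m+n∸n≡m (2 + M + (c + 1)) c) ⟩
      2 + M + (c + 1) ∸ (c + 1)          ≡⟨ m+n∸n≡m (2 + M) (c + 1) ⟩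
      2 + M                              ∎
      where
        open ≡-Reasoning
        split : ∀ c M → M + (c + c + 3) ≡ 2 + M + (c + 1) + c
        split = solve-∀

    first-term≤ : term 0 ≤ E
    first-term≤ = begin
      p′ n (c + 2 + 0)                          ≤⟨ p′≤ (k+l≡n c M) ⟩
      (c + 2 + 0) ! * (2 + (M + c + 1)) !       ≡⟨ cong₂ (λ x y → x ! * y !) (k≡ c) (2+l≡ c M) ⟩
      E                                         ∎
      where
        open ≤-Reasoning
        k+l≡n : ∀ c M → c + 2 + 0 + (M + c + 1) ≡ M + (c + c + 3)
        k+l≡n = solve-∀
        k≡ : ∀ c → c + 2 + 0 ≡ 2 + c
        k≡ = solve-∀
        2+l≡ : ∀ c M → 2 + (M + c + 1) ≡ 3 + (c + M)
        2+l≡ = solve-∀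

    last-term≤ : term (suc M) ≤ E
    last-term≤ = begin
      p′ n (c + 2 + suc M)                      ≤⟨ p′≤ (k+l≡n c M) ⟩
      (c + 2 + suc M) ! * (2 + c) !             ≡⟨ *-comm _ ((2 + c) !) ⟩
      (2 + c) ! * (c + 2 + suc M) !             ≡⟨ cong (λ x → (2 + c) ! * x !) (k≡ c M) ⟩
      E                                         ∎
      where
        open ≤-Reasoning
        k+l≡n : ∀ c M → c + 2 + suc M + c ≡ M + (c + c + 3)
        k+l≡n = solve-∀
        k≡ : ∀ c M → c + 2 + suc M ≡ 3 + (c + M)
        k≡ = solve-∀

    middle-term≤ : ∀ {j} → j < M → term (suc j) ≤ F
    middle-term≤ {j} j<M with e , refl ← m≤n⇒∃[o]m+o≡n j<M = begin
      p′ n (c + 2 + suc j)                        ≤⟨ p′≤ (k+l≡n c j e) ⟩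
      (c + 2 + suc j) ! * (2 + suc (c + e)) !     ≡⟨ cong (λ x → x ! * (3 + (c + e)) !) (k≡ c j) ⟩
      (3 + c + j) ! * (3 + (c + e)) !             ≤⟨ [a+d]!*b!≤a!*[b+d]! j (s≤s (s≤s (s≤s (m≤m+n c e)))) ⟩
      (3 + c) ! * (3 + (c + e) + j) !             ≡⟨ cong (λ x → (3 + c) ! * x !) (b+j≡ c j e) ⟩
      F                                           ∎
      where
        open ≤-Reasoning
        k+l≡n : ∀ c j e → c + 2 + suc j + suc (c + e) ≡ suc j + e + (c + c + 3)
        k+l≡n = solve-∀
        k≡ : ∀ c j → c + 2 + suc j ≡ 3 + c + j
        k≡ = solve-∀
        b+j≡ : ∀ c j e → 3 + (c + e) + j ≡ 2 + (c + (suc j + e))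
        b+j≡ = solve-∀

    estimate : n ^ c * S n c ≤ C * n !
    estimate = begin
      n ^ c * S n c
        ≡⟨ cong (λ L → n ^ c * sum (applyUpTo term L)) number-of-terms ⟩
      n ^ c * sum (applyUpTo term (2 + M))
        ≤⟨ *-monoʳ-≤ (n ^ c) (sum-applyUpTo-ends≤ term M first-term≤ last-term≤ middle-term≤) ⟩
      n ^ c * (E + (M * F + E))
        ≤⟨ *-monoʳ-≤ (n ^ c) (+-monoʳ-≤ E (+-monoˡ-≤ E (*-monoˡ-≤ F (m≤m+n M (c + c + 3))))) ⟩
      n ^ c * (E + (n * F + E))
        ≡⟨ expand (n ^ c) n ((2 + c) !) ((3 + c) !) ((3 + (c + M)) !) ((2 + (c + M)) !) ⟩
      (2 + c) ! * (n ^ c * (3 + (c + M)) !) + ((3 + c) ! * (n ^ suc c * (2 + (c + M)) !) + (2 + c) ! * (n ^ c * (3 + (c + M)) !))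
        ≤⟨ +-mono-≤ (*-monoʳ-≤ ((2 + c) !) n^c*E≤)
                    (+-mono-≤ (*-monoʳ-≤ ((3 + c) !) n^[1+c]*F≤) (*-monoʳ-≤ ((2 + c) !) n^c*E≤)) ⟩
      (2 + c) ! * (2 ^ c * n !) + ((3 + c) ! * (2 ^ suc c * n !) + (2 + c) ! * (2 ^ c * n !))
        ≡⟨ collect ((2 + c) !) ((3 + c) !) (2 ^ c) (n !) ⟩
      C * n ! ∎
      where
        open ≤-Reasoning
        expand : ∀ P n A₂ A₃ X Y →
                 P * (A₂ * X + (n * (A₃ * Y) + A₂ * X)) ≡ A₂ * (P * X) + (A₃ * (n * P * Y) + A₂ * (P * X))
        expand = solve-∀
        collect : ∀ A₂ A₃ T Q → A₂ * (T * Q) + (A₃ * (2 * T * Q) + A₂ * (T * Q)) ≡ 2 * T * (A₂ + A₃) * Q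
        collect = solve-∀
        m+c≡n : ∀ c M → 3 + (c + M) + c ≡ M + (c + c + 3)
        m+c≡n = solve-∀
        m′+[1+c]≡n : ∀ c M → 2 + (c + M) + suc c ≡ M + (c + c + 3)
        m′+[1+c]≡n = solve-∀
        n^c*E≤ : n ^ c * (3 + (c + M)) ! ≤ 2 ^ c * n !
        n^c*E≤ = n^c*m!≤2^c*n! c (m+c≡n c M) (≤-trans (m≤m+n c M) (m≤n+m (c + M) 5))
        n^[1+c]*F≤ : n ^ suc c * (2 + (c + M)) ! ≤ 2 ^ suc c * n !
        n^[1+c]*F≤ = n^c*m!≤2^c*n! (suc c) (m′+[1+c]≡n c M) (s≤s (≤-trans (m≤m+n c M) (m≤n+m (c + M) 3)))

lemma1 : ∀ (c : ℕ) → 1 ≤ c →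
    ∃ λ (C : ℕ) → ∃ λ (N : ℕ) → ∀ (n : ℕ) → N ≤ n →
      n ^ c * S n c ≤ C * n !
lemma1 c _ = Estimate.C c , c + c + 3 , λ n N≤n →
  subst (λ n → n ^ c * S n c ≤ Estimate.C c * n !) (m∸n+n≡m N≤n) (Estimate.estimate c (n ∸ (c + c + 3)))
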